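{- Let $n\ge 1$ and let $\mathcal{A}$ be any algorithm that computes the matrix product $C=AB$ of two $n\times n$ matrices using only semiring operations (additions and multiplications) on a BSP with two processors. Suppose that each processor computes at most $\epsilon n^{3}$ multiplicative terms, where $\epsilon$ is an arbitrary constant in $(1/2,1)$, and that the input matrices are not initially replicated. Then the communication complexity of $\mathcal{A}$ is $H_{\mathcal{A}}(n,2)=\Omega(n^2)$.
   Context: BSP model: $p$ processors $P_0,\dots,P_{p-1}$, each with an unbounded private local memory, connected by a communication network. A computation is a sequence of supersteps; in each superstep processors compute on local data and send messages (each message carries one data word), followed by a global synchronization. If $h_i$ is the maximum number of messages sent or received by any processor in superstep $i$, the communication complexity of algorithm $\mathcal{A}$ is $H_{\mathcal{A}}=\sum_i h_i$. Using only semiring operations, each entry $c_{i,j}$ of $C$ is computed as an explicit sum of products $a_{i,k}b_{k,j}$, called multiplicative terms. "Input matrices not initially replicated" means each entry of $A$ and $B$ initially resides in the local memory of exactly one processor; no assumption is made on which processor, nor on where outputs end up. The constant hidden in $\Omega$ may depend on $\epsilon$.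
   Formalization: The constant ε bounding each processor's multiplicative terms is a rational number in $(1/2,1)$. -}

module Defs where

open import Data.Nat using (ℕ; zero; suc; _⊔_; _^_)
open import Data.Fin using (Fin; zero; suc)
open import Data.List using (List; []; _∷_; _++_; [_]; map; length; allFin)
open import Data.Nat.ListAction using (sum)
open import Data.List.Membership.Propositional using (_∈_)
open import Data.List.Relation.Unary.All using (All)
open import Data.List.Relation.Unary.Unique.Propositional using (Unique)
open import Data.List.Relation.Binary.Pointwise using (Pointwise)
open import Data.List.Relation.Binary.Permutation.Propositional using (_↭_)
open import Data.Maybe using (Maybe; just; nothing; _>>=_)
open import Data.Product using (_×_; _,_; ∃)
open import Data.Integer using (+_)
open import Data.Rational using (ℚ; _/_; _*_; _≤_)
open import Relation.Binary.PropositionalEquality using (_≡_)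

-- Symbolic data words.  Input entries of the two n×n matrices:
--   a i k  stands for A[i][k],   b k j  stands for B[k][j].

data Var (n : ℕ) : Set where
  a : Fin n → Fin n → Var n
  b : Fin n → Fin n → Var n

data Expr (n : ℕ) : Set where
  var : Var n → Expr n
  _⊕_ : Expr n → Expr n → Expr n
  _⊗_ : Expr n → Expr n → Expr n

Proc : Set
Proc = Fin 2

-- A local semiring instruction; arguments are indices into the local
-- memory of the executing processor, the result is appended to it.
data Instr : Set where
  add : ℕ → ℕ → Instr
  mul : ℕ → ℕ → Instr

-- One superstep: local computation on each processor, then each processor
-- sends words (given by local memory indices) to the other processor,
-- then global synchronisation (received words are appended to memory).
record Superstep : Set where
  field
    compute : Proc → List Instr
    send    : Proc → List ℕ

record BSPAlgorithm (n : ℕ) : Set where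
  field
    init  : Proc → List (Var n)
    steps : List Superstep

record State (n : ℕ) : Set where
  field
    mem   : Proc → List (Expr n)
    mults : Proc → List (Expr n)

lookupℕ : {A : Set} → List A → ℕ → Maybe A
lookupℕ []       _       = nothing
lookupℕ (x ∷ xs) zero    = just x
lookupℕ (x ∷ xs) (suc i) = lookupℕ xs i

lookupAll : {A : Set} → List A → List ℕ → Maybe (List A)
lookupAll m []       = just []
lookupAll m (i ∷ is) =
  lookupℕ m i >>= λ x → lookupAll m is >>= λ xs → just (x ∷ xs)

runLocal : {n : ℕ} → List (Expr n) → List (Expr n) → List Instr →
           Maybe (List (Expr n) × List (Expr n))
runLocal m lg []              = just (m , lg)
runLocal m lg (add i j ∷ is) =
  lookupℕ m i >>= λ x → lookupℕ m j >>= λ y →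
  runLocal (m ++ [ x ⊕ y ]) lg is
runLocal m lg (mul i j ∷ is) =
  lookupℕ m i >>= λ x → lookupℕ m j >>= λ y →
  runLocal (m ++ [ x ⊗ y ]) (lg ++ [ x ⊗ y ]) is

other : Proc → Proc
other zero       = suc zero
other (suc zero) = zero

both : {X : Proc → Set} → ((q : Proc) → Maybe (X q)) → Maybe ((q : Proc) → X q)
both {X} f with f zero | f (suc zero)
... | just x | just y = just g
  where
    g : (q : Proc) → X q
    g zero       = x
    g (suc zero) = y
... | _ | _ = nothing

stepState : {n : ℕ} → Superstep → State n → Maybe (State n)
stepState {n} st s =
  both (λ q → runLocal (State.mem s q) (State.mults s q) (Superstep.compute st q))
  >>= λ loc →
  both (λ q → lookupAll (Data.Product.proj₁ (loc q)) (Superstep.send st q))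
  >>= λ out →
  just (record { mem   = λ q → Data.Product.proj₁ (loc q) ++ out (other q)
               ; mults = λ q → Data.Product.proj₂ (loc q) })

runSteps : {n : ℕ} → List Superstep → State n → Maybe (State n)
runSteps []         s = just s
runSteps (st ∷ sts) s = stepState st s >>= runSteps sts

initState : {n : ℕ} → BSPAlgorithm n → State n
initState alg = record { mem   = λ q → map var (BSPAlgorithm.init alg q)
                       ; mults = λ _ → [] }

-- final state of a (well-formed) execution; nothing if an instruction
-- refers to a non-existent memory cell
run : {n : ℕ} → BSPAlgorithm n → Maybe (State n)
run alg = runSteps (BSPAlgorithm.steps alg) (initState alg)

-- Communication complexity H_A = Σ_i h_i, where h_i is the maximum number
-- of messages sent or received by a processor in superstep i.  With two
-- processors, P_q sends |send q| words and receives |send (other q)|.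

h : Superstep → ℕ
h st = length (Superstep.send st zero) ⊔ length (Superstep.send st (suc zero))

H : {n : ℕ} → BSPAlgorithm n → ℕ
H alg = sum (map h (BSPAlgorithm.steps alg))

NotReplicated : {n : ℕ} → BSPAlgorithm n → Set
NotReplicated {n} alg =
  (v : Var n) → ∃ λ q → v ∈ BSPAlgorithm.init alg q ×
                       ((q' : Proc) → v ∈ BSPAlgorithm.init alg q' → q' ≡ q)

data IsTerm {n : ℕ} (i j k : Fin n) : Expr n → Set where
  ab : IsTerm i j k (var (a i k) ⊗ var (b k j))
  ba : IsTerm i j k (var (b k j) ⊗ var (a i k))

summands : {n : ℕ} → Expr n → List (Expr n)
summands (e ⊕ f) = summands e ++ summands f
summands e       = [ e ]

ComputesEntry : {n : ℕ} → Fin n → Fin n → Expr n → Set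
ComputesEntry {n} i j e =
  ∃ λ (ks : List (Fin n)) →
    Pointwise (λ t k → IsTerm i j k t) (summands e) ks × (ks ↭ allFin n)

ComputesProduct : {n : ℕ} → State n → Set
ComputesProduct {n} s =
  (i j : Fin n) → ∃ λ q → ∃ λ e → e ∈ State.mem s q × ComputesEntry i j e

Triple : ℕ → Set
Triple n = Fin n × Fin n × Fin n   -- (i , k , j)

TermComputedBy : {n : ℕ} → State n → Proc → Triple n → Set
TermComputedBy s q (i , k , j) = ∃ λ e → e ∈ State.mults s q × IsTerm i j k e

ℕtoℚ : ℕ → ℚ
ℕtoℚ m = + m / 1

AtMostTerms : {n : ℕ} → ℚ → State n → Proc → Set
AtMostTerms {n} ε s q =
  (ts : List (Triple n)) → Unique ts → All (TermComputedBy s q) ts →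
  ℕtoℚ (length ts) ≤ ε * ℕtoℚ (n ^ 3)

-- Let R ≤ 2H be the number of words received. Each entry c_ij ends up in the memory of some
-- processor; call it local if that processor formed all n products a_ik b_kj itself. Otherwise,
-- tracing a missing product back through the additions shows that the processor received a
-- partial sum consisting of products of c_ij only; different entries need different such words,
-- so at most R entries are not local. A processor owns at most εn² local entries (each costs n
-- products), hence processor 0 owns at least (1 - ε)n² - R of them. Computing c_ij locally needs
-- all of row i of A and column j of B, and a row held by both processors costs n received words
-- because inputs are not replicated; so processor 0 holds at least (1 - ε)n - 2R/n rows that
-- processor 1 lacks, and symmetrically processor 1 holds as many columns that processor 0 lacks.
-- No entry pairing such a row with such a column is local, so their product is at most R.

module Submission where

open import Defs
open import Data.Nat using (ℕ)
open import Data.List using (List)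

module Counting where

  open import Data.Nat using (suc; _+_; _*_; _≤_; z≤n; s≤s)
  open import Data.Nat.Properties using (≤-trans; ≤-reflexive; +-suc; +-monoʳ-≤; n≤1+n; m≤n⇒m≤1+n)
  open import Data.List using ([]; _∷_; _++_; map; length; filter; cartesianProduct)
  open import Data.List.Properties using (length-++; length-map; length-removeAt′; filter-++; filter-all; filter-none; filter-≐)
  open import Data.List.Membership.Propositional using (_∈_; _─_)
  open import Data.List.Relation.Unary.Any using (here; there; index)
  open import Data.List.Relation.Unary.All as All using ()
  open import Data.List.Relation.Unary.AllPairs using (_∷_)
  open import Data.List.Relation.Unary.Unique.Propositional using (Unique)
  open import Data.Product using (_×_; _,_; ∃; proj₁; proj₂)
  open import Data.Unit using (tt)
  open import Function using (_∘_)
  open import Level using (0ℓ)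
  open import Relation.Nullary using (yes; no; ¬_; contradiction)
  open import Relation.Unary using (Pred; Decidable; _⊆_; _≐_)
  open import Relation.Unary.Properties using (_∪?_; _×?_; U?)
  open import Relation.Binary.PropositionalEquality using (_≡_; _≢_; refl; sym; trans; cong; cong₂; module ≡-Reasoning)

  private
    variable
      A B : Set

  count : {P : Pred A 0ℓ} → Decidable P → List A → ℕ
  count P? xs = length (filter P? xs)

  ∈-─ : {x y : A} {ys : List A} → x ∈ ys → (y∈ys : y ∈ ys) → x ≢ y → x ∈ ys ─ y∈ys
  ∈-─ (here refl)  (here refl)  x≢y = contradiction refl x≢y
  ∈-─ (there x∈ys) (here refl)  x≢y = x∈ys
  ∈-─ (here refl)  (there y∈ys) x≢y = here refl
  ∈-─ (there x∈ys) (there y∈ys) x≢y = there (∈-─ x∈ys y∈ys x≢y)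

  length-cartesianProduct : (xs : List A) (ys : List B) →
    length (cartesianProduct xs ys) ≡ length xs * length ys
  length-cartesianProduct []       ys = refl
  length-cartesianProduct (x ∷ xs) ys = trans (length-++ (map (x ,_) ys))
    (cong₂ _+_ (length-map (x ,_) ys) (length-cartesianProduct xs ys))

  module _ {P Q : Pred A 0ℓ} (P? : Decidable P) (Q? : Decidable Q) where

    count-mono : P ⊆ Q → ∀ xs → count P? xs ≤ count Q? xs
    count-mono P⊆Q []       = z≤n
    count-mono P⊆Q (x ∷ xs) with P? x | Q? x
    ... | yes _ | yes _ = s≤s (count-mono P⊆Q xs)
    ... | yes p | no ¬q = contradiction (P⊆Q p) ¬q
    ... | no _  | yes _ = m≤n⇒m≤1+n (count-mono P⊆Q xs)
    ... | no _  | no _  = count-mono P⊆Q xs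

    count-≐ : P ≐ Q → ∀ xs → count P? xs ≡ count Q? xs
    count-≐ P≐Q xs = cong length (filter-≐ P? Q? P≐Q xs)

    count-∪ : ∀ xs → count (P? ∪? Q?) xs ≤ count P? xs + count Q? xs
    count-∪ []       = z≤n
    count-∪ (x ∷ xs) with P? x | Q? x
    ... | yes _ | yes _ = s≤s (≤-trans (count-∪ xs) (+-monoʳ-≤ (count P? xs) (n≤1+n _)))
    ... | yes _ | no _  = s≤s (count-∪ xs)
    ... | no _  | yes _ = ≤-trans (s≤s (count-∪ xs)) (≤-reflexive (sym (+-suc _ _)))
    ... | no _  | no _  = count-∪ xs

  module _ {P : Pred A 0ℓ} (P? : Decidable P) where

    count-++ : ∀ xs ys → count P? (xs ++ ys) ≡ count P? xs + count P? ys
    count-++ xs ys = trans (cong length (filter-++ P? xs ys)) (length-++ (filter P? xs))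

    count-map : (f : B → A) → ∀ xs → count P? (map f xs) ≡ count (P? ∘ f) xs
    count-map f []       = refl
    count-map f (x ∷ xs) with P? (f x)
    ... | yes _ = cong suc (count-map f xs)
    ... | no _  = count-map f xs

    count-universal : (∀ x → P x) → ∀ xs → count P? xs ≡ length xs
    count-universal all xs = cong length (filter-all P? (All.universal all xs))

    count-empty : (∀ x → ¬ P x) → ∀ xs → count P? xs ≡ 0
    count-empty none xs = cong length (filter-none P? (All.universal none xs))

    injection⇒count≤length : (R : A → B → Set) → (∀ {x x′ w} → R x w → R x′ w → x ≡ x′) →
      ∀ {xs} → Unique xs → ∀ ys → (∀ {x} → x ∈ xs → P x → ∃ λ w → w ∈ ys × R x w) →
      count P? xs ≤ length ys
    injection⇒count≤length R R-inj {[]}     _             ys witness = z≤n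
    injection⇒count≤length R R-inj {x ∷ xs} (x∉xs ∷ xs!) ys witness with P? x
    ... | no _  = injection⇒count≤length R R-inj xs! ys (witness ∘ there)
    ... | yes p with w , w∈ys , Rxw ← witness (here refl) p = ≤-trans
            (s≤s (injection⇒count≤length R R-inj xs! (ys ─ w∈ys) witness′))
            (≤-reflexive (sym (length-removeAt′ ys (index w∈ys))))
      where
      witness′ : ∀ {x′} → x′ ∈ xs → P x′ → ∃ λ w′ → w′ ∈ ys ─ w∈ys × R x′ w′
      witness′ x′∈xs px′ with w′ , w′∈ys , Rx′w′ ← witness (there x′∈xs) px′ =
        w′ , ∈-─ w′∈ys w∈ys (λ { refl → All.lookup x∉xs x′∈xs (R-inj Rxw Rx′w′) }) , Rx′w′

  module _ {P : Pred A 0ℓ} {Q : Pred B 0ℓ} (P? : Decidable P) (Q? : Decidable Q) where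

    count-⟨×⟩ : ∀ xs ys → count (P? ×? Q?) (cartesianProduct xs ys) ≡ count P? xs * count Q? ys
    count-⟨×⟩ []       ys = refl
    count-⟨×⟩ (x ∷ xs) ys = begin
      count (P? ×? Q?) (map (x ,_) ys ++ cartesianProduct xs ys)
        ≡⟨ count-++ (P? ×? Q?) (map (x ,_) ys) _ ⟩
      count (P? ×? Q?) (map (x ,_) ys) + count (P? ×? Q?) (cartesianProduct xs ys)
        ≡⟨ cong₂ _+_ (count-map (P? ×? Q?) (x ,_) ys) (count-⟨×⟩ xs ys) ⟩
      count (λ y → (P? ×? Q?) (x , y)) ys + count P? xs * count Q? ys
        ≡⟨ row ⟩
      count P? (x ∷ xs) * count Q? ys ∎
      where
      open ≡-Reasoning
      row : count (λ y → (P? ×? Q?) (x , y)) ys + count P? xs * count Q? ys ≡ count P? (x ∷ xs) * count Q? ys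
      row with P? x
      ... | yes px = cong (_+ _) (count-≐ _ Q? (proj₂ , (px ,_)) ys)
      ... | no ¬px = cong (_+ _) (count-empty _ (λ _ → ¬px ∘ proj₁) ys)

  module _ {P : Pred A 0ℓ} (P? : Decidable P) where

    count-proj₁ : ∀ xs (ys : List B) → count (P? ∘ proj₁) (cartesianProduct xs ys) ≡ count P? xs * length ys
    count-proj₁ xs ys = begin
      count (P? ∘ proj₁) (cartesianProduct xs ys)
        ≡⟨ count-≐ (P? ∘ proj₁) (P? ×? U?) ((_, tt) , proj₁) (cartesianProduct xs ys) ⟩
      count (P? ×? U?) (cartesianProduct xs ys)    ≡⟨ count-⟨×⟩ P? U? xs ys ⟩
      count P? xs * count U? ys                    ≡⟨ cong (count P? xs *_) (count-universal U? _ ys) ⟩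
      count P? xs * length ys                      ∎
      where open ≡-Reasoning

    count-proj₂ : ∀ (xs : List B) ys → count (P? ∘ proj₂) (cartesianProduct xs ys) ≡ length xs * count P? ys
    count-proj₂ xs ys = begin
      count (P? ∘ proj₂) (cartesianProduct xs ys)
        ≡⟨ count-≐ (P? ∘ proj₂) (U? ×? P?) ((tt ,_) , proj₂) (cartesianProduct xs ys) ⟩
      count (U? ×? P?) (cartesianProduct xs ys)    ≡⟨ count-⟨×⟩ U? P? xs ys ⟩
      count U? xs * count P? ys                    ≡⟨ cong (_* count P? ys) (count-universal U? _ xs) ⟩
      length xs * count P? ys                      ∎
      where open ≡-Reasoning

module Execution where

  open import Data.Nat using (zero; suc; _+_; _≤_)
  open import Data.Nat.Properties
    using (≤-trans; ≤-reflexive; +-monoˡ-≤; +-monoʳ-≤; +-mono-≤; m≤m⊔n; m≤n⊔m; m≤m+n; +-assoc;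
           +-commutativeSemigroup; module ≤-Reasoning)
  open import Algebra.Properties.CommutativeSemigroup +-commutativeSemigroup using (interchange)
  open import Data.Nat.ListAction using (sum)
  open import Data.Fin using (zero; suc)
  open import Data.List using ([]; _∷_; _++_; [_]; map; length)
  open import Data.List.Properties using (length-++)
  open import Data.List.Membership.Propositional using (_∈_)
  open import Data.List.Membership.Propositional.Properties using (∈-++⁺ʳ; ∈-++⁻; ∈-map⁻)
  open import Data.List.Relation.Unary.Any using (here; there)
  open import Data.List.Relation.Binary.Subset.Propositional using (_⊆_)
  open import Data.List.Relation.Binary.Subset.Propositional.Properties using (xs⊆xs++ys)
  open import Data.Maybe using (Maybe; just; nothing; _>>=_)
  open import Data.Product as Product using (_×_; _,_; ∃; proj₁; proj₂)
  open import Data.Sum using (inj₁; inj₂)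
  open import Function using (id; _∘_)
  open import Relation.Binary.PropositionalEquality using (_≡_; refl; cong; cong₂)

  >>=-just⁻ : {A B : Set} (mx : Maybe A) {f : A → Maybe B} {y : B} →
    (mx >>= f) ≡ just y → ∃ λ x → mx ≡ just x × f x ≡ just y
  >>=-just⁻ (just x) eq = x , refl , eq

  both-just⁻ : {X : Proc → Set} (f : (q : Proc) → Maybe (X q)) {g : (q : Proc) → X q} →
    both f ≡ just g → ∀ q → f q ≡ just (g q)
  both-just⁻ f eq zero with f zero | f (suc zero)
  both-just⁻ f refl zero | just x | just y = refl
  both-just⁻ f ()   zero | just x | nothing
  both-just⁻ f ()   zero | nothing | _
  both-just⁻ f eq (suc zero) with f zero | f (suc zero)
  both-just⁻ f refl (suc zero) | just x | just y = refl
  both-just⁻ f ()   (suc zero) | just x | nothing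
  both-just⁻ f ()   (suc zero) | nothing | _

  lookupℕ-∈ : {A : Set} (xs : List A) (i : ℕ) {x : A} → lookupℕ xs i ≡ just x → x ∈ xs
  lookupℕ-∈ (y ∷ xs) zero    refl = here refl
  lookupℕ-∈ (y ∷ xs) (suc i) eq   = there (lookupℕ-∈ xs i eq)

  length-lookupAll : {A : Set} (xs : List A) (is : List ℕ) {ys : List A} →
    lookupAll xs is ≡ just ys → length ys ≡ length is
  length-lookupAll xs []       refl = refl
  length-lookupAll xs (i ∷ is) eq with >>=-just⁻ (lookupℕ xs i) eq
  ... | _ , _ , eq′ with >>=-just⁻ (lookupAll xs is) eq′
  ... | _ , eq″ , refl = cong suc (length-lookupAll xs is eq″)

  module _ {n : ℕ} where

    -- How a word e in the memory M of a processor arose, where I are its initial inputs,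
    -- Rc the words it has received and Ml the log of products it has formed.
    data Provenance (I : List (Var n)) (Rc M Ml : List (Expr n)) : Expr n → Set where
      input      : ∀ {v}   → v ∈ I → Provenance I Rc M Ml (var v)
      received   : ∀ {e}   → e ∈ Rc → Provenance I Rc M Ml e
      added      : ∀ {x y} → x ∈ M → y ∈ M → Provenance I Rc M Ml (x ⊕ y)
      multiplied : ∀ {x y} → x ⊗ y ∈ Ml → Provenance I Rc M Ml (x ⊗ y)

    provenance-mono : ∀ {I Rc Rc′ M M′ Ml Ml′ e} → Rc ⊆ Rc′ → M ⊆ M′ → Ml ⊆ Ml′ →
      Provenance I Rc M Ml e → Provenance I Rc′ M′ Ml′ e
    provenance-mono _   _  _   (input v∈I)        = input v∈I
    provenance-mono Rc⊆ _  _   (received e∈Rc)    = received (Rc⊆ e∈Rc)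
    provenance-mono _   M⊆ _   (added x∈M y∈M)    = added (M⊆ x∈M) (M⊆ y∈M)
    provenance-mono _   _  Ml⊆ (multiplied xy∈Ml) = multiplied (Ml⊆ xy∈Ml)

    record Traced (I : List (Var n)) (Rc M Ml : List (Expr n)) : Set where
      field
        provenance : ∀ {e} → e ∈ M → Provenance I Rc M Ml e
        factors    : ∀ {x y} → x ⊗ y ∈ Ml → x ∈ M × y ∈ M
    open Traced public

    traced-add : ∀ {I Rc M Ml x y} → Traced I Rc M Ml → x ∈ M → y ∈ M →
      Traced I Rc (M ++ [ x ⊕ y ]) Ml
    traced-add {I} {Rc} {M} {Ml} {x} {y} tr x∈M y∈M = record
      { provenance = provenance′
      ; factors    = Product.map M⊆ M⊆ ∘ factors tr }
      where
      M⊆ = xs⊆xs++ys M [ x ⊕ y ]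
      provenance′ : ∀ {e} → e ∈ M ++ [ x ⊕ y ] → Provenance I Rc (M ++ [ x ⊕ y ]) Ml e
      provenance′ e∈ with ∈-++⁻ M e∈
      ... | inj₁ e∈M         = provenance-mono id M⊆ id (provenance tr e∈M)
      ... | inj₂ (here refl) = added (M⊆ x∈M) (M⊆ y∈M)

    traced-mul : ∀ {I Rc M Ml x y} → Traced I Rc M Ml → x ∈ M → y ∈ M →
      Traced I Rc (M ++ [ x ⊗ y ]) (Ml ++ [ x ⊗ y ])
    traced-mul {I} {Rc} {M} {Ml} {x} {y} tr x∈M y∈M = record
      { provenance = provenance′
      ; factors    = factors′ }
      where
      M⊆  = xs⊆xs++ys M [ x ⊗ y ]
      Ml⊆ = xs⊆xs++ys Ml [ x ⊗ y ]
      provenance′ : ∀ {e} → e ∈ M ++ [ x ⊗ y ] → Provenance I Rc (M ++ [ x ⊗ y ]) (Ml ++ [ x ⊗ y ]) e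
      provenance′ e∈ with ∈-++⁻ M e∈
      ... | inj₁ e∈M         = provenance-mono id M⊆ Ml⊆ (provenance tr e∈M)
      ... | inj₂ (here refl) = multiplied (∈-++⁺ʳ Ml (here refl))
      factors′ : ∀ {u v} → u ⊗ v ∈ Ml ++ [ x ⊗ y ] → u ∈ M ++ [ x ⊗ y ] × v ∈ M ++ [ x ⊗ y ]
      factors′ uv∈ with ∈-++⁻ Ml uv∈
      ... | inj₁ uv∈Ml       = Product.map M⊆ M⊆ (factors tr uv∈Ml)
      ... | inj₂ (here refl) = M⊆ x∈M , M⊆ y∈M

    traced-receive : ∀ {I Rc M Ml} (ws : List (Expr n)) → Traced I Rc M Ml →
      Traced I (Rc ++ ws) (M ++ ws) Ml
    traced-receive {I} {Rc} {M} {Ml} ws tr = record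
      { provenance = provenance′
      ; factors    = Product.map M⊆ M⊆ ∘ factors tr }
      where
      M⊆ = xs⊆xs++ys M ws
      provenance′ : ∀ {e} → e ∈ M ++ ws → Provenance I (Rc ++ ws) (M ++ ws) Ml e
      provenance′ e∈ with ∈-++⁻ M e∈
      ... | inj₁ e∈M  = provenance-mono (xs⊆xs++ys Rc ws) M⊆ id (provenance tr e∈M)
      ... | inj₂ e∈ws = received (∈-++⁺ʳ Rc e∈ws)

    traced-runLocal : ∀ {I Rc} M Ml is {M′ Ml′} → runLocal M Ml is ≡ just (M′ , Ml′) →
      Traced I Rc M Ml → Traced I Rc M′ Ml′
    traced-runLocal M Ml []             refl tr = tr
    traced-runLocal M Ml (add i j ∷ is) run≡ tr
      with x , x≡ , run≡′ ← >>=-just⁻ (lookupℕ M i) run≡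
      with y , y≡ , run≡″ ← >>=-just⁻ (lookupℕ M j) run≡′
      = traced-runLocal _ Ml is run≡″ (traced-add tr (lookupℕ-∈ M i x≡) (lookupℕ-∈ M j y≡))
    traced-runLocal M Ml (mul i j ∷ is) run≡ tr
      with x , x≡ , run≡′ ← >>=-just⁻ (lookupℕ M i) run≡
      with y , y≡ , run≡″ ← >>=-just⁻ (lookupℕ M j) run≡′
      = traced-runLocal _ _ is run≡″ (traced-mul tr (lookupℕ-∈ M i x≡) (lookupℕ-∈ M j y≡))

    TracedState : (Proc → List (Var n)) → (Proc → List (Expr n)) → State n → Set
    TracedState I Rc s = ∀ q → Traced (I q) (Rc q) (State.mem s q) (State.mults s q)

    received-total : (Proc → List (Expr n)) → ℕ
    received-total Rc = length (Rc zero) + length (Rc (suc zero))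

    computeLocally : Superstep → State n → (q : Proc) → Maybe (List (Expr n) × List (Expr n))
    computeLocally st s q = runLocal (State.mem s q) (State.mults s q) (Superstep.compute st q)

    outgoing : Superstep → ((q : Proc) → List (Expr n) × List (Expr n)) → (q : Proc) → Maybe (List (Expr n))
    outgoing st loc q = lookupAll (proj₁ (loc q)) (Superstep.send st q)

    traced-step : ∀ {I Rc} st s {s′} → stepState st s ≡ just s′ → TracedState I Rc s →
      ∃ λ Rc′ → TracedState I Rc′ s′ × received-total Rc′ ≤ received-total Rc + (h st + h st)
    traced-step {I} {Rc} st s step≡ tr
      with loc , loc≡ , step≡′ ← >>=-just⁻ (both (computeLocally st s)) step≡
      with out , out≡ , refl   ← >>=-just⁻ (both (outgoing st loc)) step≡′
      = Rc′ , tr′ , bound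
      where
      Rc′ : Proc → List (Expr n)
      Rc′ q = Rc q ++ out (other q)
      tr′ : ∀ q → Traced (I q) (Rc′ q) (proj₁ (loc q) ++ out (other q)) (proj₂ (loc q))
      tr′ q = traced-receive (out (other q))
                (traced-runLocal _ _ (Superstep.compute st q) (both-just⁻ (computeLocally st s) loc≡ q) (tr q))
      out≤h : ∀ q → length (out q) ≤ h st
      out≤h q with length-lookupAll _ (Superstep.send st q) (both-just⁻ (outgoing st loc) out≡ q)
      out≤h zero       | eq = ≤-trans (≤-reflexive eq) (m≤m⊔n _ _)
      out≤h (suc zero) | eq = ≤-trans (≤-reflexive eq) (m≤n⊔m _ _)
      open ≤-Reasoning
      bound : received-total Rc′ ≤ received-total Rc + (h st + h st)
      bound = begin
        length (Rc zero ++ out (suc zero)) + length (Rc (suc zero) ++ out zero)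
          ≡⟨ cong₂ _+_ (length-++ (Rc zero)) (length-++ (Rc (suc zero))) ⟩
        (length (Rc zero) + length (out (suc zero))) + (length (Rc (suc zero)) + length (out zero))
          ≡⟨ interchange (length (Rc zero)) (length (out (suc zero))) (length (Rc (suc zero))) (length (out zero)) ⟩
        received-total Rc + (length (out (suc zero)) + length (out zero))
          ≤⟨ +-monoʳ-≤ (received-total Rc) (+-mono-≤ (out≤h (suc zero)) (out≤h zero)) ⟩
        received-total Rc + (h st + h st) ∎

    traced-runSteps : ∀ {I Rc} sts s {s′} → runSteps sts s ≡ just s′ → TracedState I Rc s →
      ∃ λ Rc′ → TracedState I Rc′ s′ ×
        received-total Rc′ ≤ received-total Rc + (sum (map h sts) + sum (map h sts))
    traced-runSteps {Rc = Rc} [] s refl tr = Rc , tr , m≤m+n _ _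
    traced-runSteps {Rc = Rc} (st ∷ sts) s run≡ tr
      with s₁ , step≡ , run≡′ ← >>=-just⁻ (stepState st s) run≡
      with Rc₁ , tr₁ , bound₁ ← traced-step st s step≡ tr
      with Rc₂ , tr₂ , bound₂ ← traced-runSteps sts s₁ run≡′ tr₁
      = Rc₂ , tr₂ , (begin
        received-total Rc₂                                   ≤⟨ bound₂ ⟩
        received-total Rc₁ + (S + S)                         ≤⟨ +-monoˡ-≤ (S + S) bound₁ ⟩
        received-total Rc + (h st + h st) + (S + S)          ≡⟨ +-assoc (received-total Rc) _ _ ⟩
        received-total Rc + ((h st + h st) + (S + S))        ≡⟨ cong (received-total Rc +_) (interchange (h st) (h st) S S) ⟩
        received-total Rc + ((h st + S) + (h st + S))        ∎)
      where
      S = sum (map h sts)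
      open ≤-Reasoning

    traced-run : (alg : BSPAlgorithm n) {s : State n} → run alg ≡ just s →
      ∃ λ Rc → TracedState (BSPAlgorithm.init alg) Rc s × received-total Rc ≤ H alg + H alg
    traced-run alg run≡ = traced-runSteps (BSPAlgorithm.steps alg) (initState alg) run≡ initial
      where
      initial : TracedState (BSPAlgorithm.init alg) (λ _ → []) (initState alg)
      initial q = record { provenance = from-input ; factors = λ () }
        where
        from-input : ∀ {e} → e ∈ map var (BSPAlgorithm.init alg q) → Provenance _ [] _ [] e
        from-input e∈ with v , v∈ , refl ← ∈-map⁻ var e∈ = input v∈

module Terms where

  open Execution
  open import Data.Fin using (Fin)
  open import Data.Fin.Properties using (_≟_; all?; ¬∀⟶∃¬)
  open import Data.List.Membership.Propositional using (_∈_; find; lose)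
  open import Data.List.Membership.Propositional.Properties using (∈-++⁺ˡ; ∈-++⁻; ∈-allFin)
  open import Data.List.Relation.Unary.Any using (here; there; any?)
  open import Data.List.Relation.Unary.All as All using (All; _∷_)
  open import Data.List.Relation.Unary.All.Properties using (++⁻ˡ; ++⁻ʳ)
  open import Data.List.Relation.Binary.Pointwise using (Pointwise; []; _∷_)
  open import Data.List.Relation.Binary.Permutation.Propositional using (↭-sym)
  open import Data.List.Relation.Binary.Permutation.Propositional.Properties using (∈-resp-↭)
  open import Data.Product using (_×_; _,_; ∃; proj₂)
  open import Data.Sum using (_⊎_; inj₁; inj₂)
  open import Relation.Nullary using (Dec; yes; no; contradiction)
  open import Relation.Nullary.Decidable using (map′; _×-dec_)
  open import Relation.Binary.Definitions using (DecidableEquality)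
  open import Relation.Binary.PropositionalEquality using (_≡_; refl; cong)

  module _ {n : ℕ} where

    _≟ᵛ_ : DecidableEquality (Var n)
    a i k ≟ᵛ a i′ k′ = map′ (λ { (refl , refl) → refl }) (λ { refl → refl , refl }) (i ≟ i′ ×-dec k ≟ k′)
    b k j ≟ᵛ b k′ j′ = map′ (λ { (refl , refl) → refl }) (λ { refl → refl , refl }) (k ≟ k′ ×-dec j ≟ j′)
    a _ _ ≟ᵛ b _ _ = no λ ()
    b _ _ ≟ᵛ a _ _ = no λ ()

    var-injective : ∀ {u v : Var n} → var u ≡ var v → u ≡ v
    var-injective refl = refl

    _≟ᵉ_ : DecidableEquality (Expr n)
    var u   ≟ᵉ var v     = map′ (cong var) (λ { refl → refl }) (u ≟ᵛ v)
    (x ⊕ y) ≟ᵉ (x′ ⊕ y′) = map′ (λ { (refl , refl) → refl }) (λ { refl → refl , refl }) (x ≟ᵉ x′ ×-dec y ≟ᵉ y′)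
    (x ⊗ y) ≟ᵉ (x′ ⊗ y′) = map′ (λ { (refl , refl) → refl }) (λ { refl → refl , refl }) (x ≟ᵉ x′ ×-dec y ≟ᵉ y′)
    var _   ≟ᵉ (_ ⊕ _)   = no λ ()
    var _   ≟ᵉ (_ ⊗ _)   = no λ ()
    (_ ⊕ _) ≟ᵉ var _     = no λ ()
    (_ ⊕ _) ≟ᵉ (_ ⊗ _)   = no λ ()
    (_ ⊗ _) ≟ᵉ var _     = no λ ()
    (_ ⊗ _) ≟ᵉ (_ ⊕ _)   = no λ ()

    isTerm? : (i j k : Fin n) (e : Expr n) → Dec (IsTerm i j k e)
    isTerm? i j k e with e ≟ᵉ (var (a i k) ⊗ var (b k j)) | e ≟ᵉ (var (b k j) ⊗ var (a i k))
    ... | yes refl | _        = yes ab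
    ... | no _     | yes refl = yes ba
    ... | no ≢ab   | no ≢ba   = no λ { ab → ≢ab refl ; ba → ≢ba refl }

    termComputedBy? : (s : State n) (q : Proc) (t : Triple n) → Dec (TermComputedBy s q t)
    termComputedBy? s q (i , k , j) =
      map′ find (λ (_ , e∈ , term) → lose e∈ term) (any? (isTerm? i j k) (State.mults s q))

    TermOf : Fin n → Fin n → Expr n → Set
    TermOf i j t = ∃ λ k → IsTerm i j k t

    AllTermsOf : Fin n → Fin n → Expr n → Set
    AllTermsOf i j w = All (TermOf i j) (summands w)

    summand : (w : Expr n) → ∃ λ t → t ∈ summands w
    summand (var v) = _ , here refl
    summand (x ⊗ y) = _ , here refl
    summand (x ⊕ y) with t , t∈ ← summand x = t , ∈-++⁺ˡ t∈

    AllTermsOf-injective : ∀ {i j i′ j′ w} → AllTermsOf i j w → AllTermsOf i′ j′ w → i ≡ i′ × j ≡ j′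
    AllTermsOf-injective {w = w} terms terms′ with t , t∈ ← summand w
      = same-entry (proj₂ (All.lookup terms t∈)) (proj₂ (All.lookup terms′ t∈))
      where
      same-entry : ∀ {i j k i′ j′ k′ t} → IsTerm i j k t → IsTerm i′ j′ k′ t → i ≡ i′ × j ≡ j′
      same-entry ab ab = refl , refl
      same-entry ba ba = refl , refl

    summand-logged-or-received : ∀ {I Rc M Ml} {i j : Fin n} → Traced I Rc M Ml →
      ∀ {f} → f ∈ M → AllTermsOf i j f → ∀ {t} → t ∈ summands f →
      t ∈ Ml ⊎ ∃ λ w → w ∈ Rc × AllTermsOf i j w
    summand-logged-or-received tr {var v} f∈M ((_ , ()) ∷ _) _
    summand-logged-or-received tr {x ⊕ y} f∈M terms t∈ with provenance tr f∈M
    ... | received f∈Rc = inj₂ (_ , f∈Rc , terms)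
    ... | added x∈M y∈M with ∈-++⁻ (summands x) t∈
    ...   | inj₁ t∈x = summand-logged-or-received tr x∈M (++⁻ˡ (summands x) terms) t∈x
    ...   | inj₂ t∈y = summand-logged-or-received tr y∈M (++⁻ʳ (summands x) terms) t∈y
    summand-logged-or-received tr {x ⊗ y} f∈M terms (here refl) with provenance tr f∈M
    ... | received f∈Rc   = inj₂ (_ , f∈Rc , terms)
    ... | multiplied f∈Ml = inj₁ f∈Ml

    ComputesEntry⇒AllTermsOf : ∀ {i j : Fin n} {e} → ComputesEntry i j e → AllTermsOf i j e
    ComputesEntry⇒AllTermsOf (_ , pw , _) = labels pw
      where
      labels : ∀ {i j ts ks} → Pointwise (λ t k → IsTerm i j k t) ts ks → All (TermOf i j) ts
      labels []          = All.[]
      labels (term ∷ pw) = (_ , term) ∷ labels pw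

    ComputesEntry⇒term : ∀ {i j : Fin n} {e} → ComputesEntry i j e →
      ∀ k → ∃ λ t → t ∈ summands e × IsTerm i j k t
    ComputesEntry⇒term (ks , pw , ks↭) k = pointwise-∈ pw (∈-resp-↭ (↭-sym ks↭) (∈-allFin k))
      where
      pointwise-∈ : ∀ {ts ks k} → Pointwise (λ t k → IsTerm _ _ k t) ts ks → k ∈ ks →
        ∃ λ t → t ∈ ts × IsTerm _ _ k t
      pointwise-∈ (term ∷ _) (here refl) = _ , here refl , term
      pointwise-∈ (_ ∷ pw) (there k∈) with t , t∈ , term ← pointwise-∈ pw k∈ = t , there t∈ , term

    Local : State n → Proc → Fin n → Fin n → Set
    Local s q i j = ∀ k → TermComputedBy s q (i , k , j)

    local? : ∀ s q i j → Dec (Local s q i j)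
    local? s q i j = all? (λ k → termComputedBy? s q (i , k , j))

    entry-local-or-received : ∀ {I Rc} (s : State n) q → Traced I Rc (State.mem s q) (State.mults s q) →
      ∀ {i j e} → e ∈ State.mem s q → ComputesEntry i j e →
      Local s q i j ⊎ ∃ λ w → w ∈ Rc × AllTermsOf i j w
    entry-local-or-received s q tr {i} {j} {e} e∈ computes with local? s q i j
    ... | yes local = inj₁ local
    ... | no ¬local
      with k , ¬term ← ¬∀⟶∃¬ n _ (λ k → termComputedBy? s q (i , k , j)) ¬local
      with t , t∈ , term ← ComputesEntry⇒term {e = e} computes k
      with summand-logged-or-received tr e∈ (ComputesEntry⇒AllTermsOf {e = e} computes) t∈
    ... | inj₁ t∈Ml = contradiction (t , t∈Ml , term) ¬term
    ... | inj₂ sent = inj₂ sent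

module Rationals where

  open import Data.Nat as ℕ using (suc; pred)
  open import Data.Nat.Coprimality using (1-coprimeTo; sym)
  open import Data.Integer as ℤ using (+_; +≤+)
  open import Data.Integer.Properties as ℤP using (module ≤-Reasoning)
  open import Data.Rational using (ℚ; mkℚ; _/_; _≤_; _<_; _*_; 0ℚ; 1ℚ; ↧ₙ_; toℚᵘ)
  open import Data.Rational.Properties
    using (normalize-coprime; normalize-pos; positive⁻¹; toℚᵘ-mono-≤; toℚᵘ-mono-<; toℚᵘ-cancel-≤; toℚᵘ-homo-*)
  import Data.Rational.Unnormalised as ℚᵘ
  open import Data.Rational.Unnormalised.Properties using (≤-respʳ-≃; ≤-respˡ-≃; ≃-sym)
  import Data.Nat.Properties as ℕP
  open import Relation.Binary.PropositionalEquality using (_≡_; refl; cong; subst₂)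

  toℚᵘ-ℕtoℚ : ∀ m → toℚᵘ (ℕtoℚ m) ≡ ℚᵘ.mkℚᵘ (+ m) 0
  toℚᵘ-ℕtoℚ m rewrite normalize-coprime (sym (1-coprimeTo m)) = refl

  toℚᵘ-1/suc : ∀ k → toℚᵘ (+ 1 / suc k) ≡ ℚᵘ.mkℚᵘ (+ 1) k
  toℚᵘ-1/suc k rewrite normalize-coprime {1} {k} (1-coprimeTo (suc k)) = refl

  0<1/ : ∀ k .{{_ : ℕ.NonZero k}} → 0ℚ < + 1 / k
  0<1/ k = positive⁻¹ (+ 1 / k) {{normalize-pos 1 k}}

  -- For the reduced denominator d of ε, ε < 1 forces ε ≤ (d - 1) / d.
  ℕtoℚ-≤-*⇒ : ∀ (ε : ℚ) m N → ε < 1ℚ → ℕtoℚ m ≤ ε * ℕtoℚ N → m ℕ.* ↧ₙ ε ℕ.≤ pred (↧ₙ ε) ℕ.* N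
  ℕtoℚ-≤-*⇒ ε@(mkℚ ν d′ _) m N ε<1 m≤εN = ℤP.drop‿+≤+ (begin
    + (m ℕ.* suc d′)              ≡⟨ cong (λ z → + (m ℕ.* z)) (ℕP.*-identityʳ (suc d′)) ⟨
    + (m ℕ.* (suc d′ ℕ.* 1))      ≡⟨ ℤP.pos-* m _ ⟩
    + m ℤ.* + (suc d′ ℕ.* 1)      ≤⟨ cross-multiplied ⟩
    (ν ℤ.* + N) ℤ.* + 1           ≡⟨ ℤP.*-identityʳ _ ⟩
    ν ℤ.* + N                     ≤⟨ ℤP.*-monoʳ-≤-nonNeg (+ N) ν≤d′ ⟩
    + d′ ℤ.* + N                  ≡⟨ ℤP.pos-* d′ N ⟨
    + (d′ ℕ.* N)                  ∎)
    where
    open ≤-Reasoning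
    cross-multiplied : + m ℤ.* + (suc d′ ℕ.* 1) ℤ.≤ (ν ℤ.* + N) ℤ.* + 1
    cross-multiplied with ℚᵘ.*≤* le ← subst₂ ℚᵘ._≤_ (toℚᵘ-ℕtoℚ m) (cong (toℚᵘ ε ℚᵘ.*_) (toℚᵘ-ℕtoℚ N))
                          (≤-respʳ-≃ (toℚᵘ-homo-* ε (ℕtoℚ N)) (toℚᵘ-mono-≤ m≤εN)) = le
    ν≤d′ : ν ℤ.≤ + d′
    ν≤d′ with ℚᵘ.*<* lt ← toℚᵘ-mono-< ε<1 =
      ℤP.i<j⇒i≤pred[j] (subst₂ ℤ._<_ (ℤP.*-identityʳ ν) (ℤP.*-identityˡ (+ suc d′)) lt)

  1/-*-ℕtoℚ-≤ : ∀ k .{{_ : ℕ.NonZero k}} m y → m ℕ.≤ k ℕ.* y → (+ 1 / k) * ℕtoℚ m ≤ ℕtoℚ y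
  1/-*-ℕtoℚ-≤ k@(suc k′) m y m≤ky = toℚᵘ-cancel-≤ (≤-respˡ-≃ (≃-sym (toℚᵘ-homo-* (+ 1 / k) (ℕtoℚ m))) le)
    where
    le : toℚᵘ (+ 1 / k) ℚᵘ.* toℚᵘ (ℕtoℚ m) ℚᵘ.≤ toℚᵘ (ℕtoℚ y)
    le rewrite toℚᵘ-1/suc k′ | toℚᵘ-ℕtoℚ m | toℚᵘ-ℕtoℚ y = ℚᵘ.*≤* (begin
      (+ 1 ℤ.* + m) ℤ.* + 1       ≡⟨ ℤP.*-identityʳ _ ⟩
      + 1 ℤ.* + m                 ≡⟨ ℤP.*-identityˡ _ ⟩
      + m                         ≤⟨ +≤+ m≤ky ⟩
      + (k ℕ.* y)                 ≡⟨ cong +_ (ℕP.*-comm k y) ⟩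
      + (y ℕ.* k)                 ≡⟨ cong (λ z → + (y ℕ.* z)) (ℕP.*-identityʳ k) ⟨
      + (y ℕ.* (k ℕ.* 1))         ≡⟨ ℤP.pos-* y _ ⟩
      + y ℤ.* + (k ℕ.* 1)         ∎)
      where open ≤-Reasoning

module Arithmetic where

  open import Data.Nat using (zero; suc; _+_; _*_; _^_; _≤_; _<_; _≤?_; z≤n)
  open import Data.Nat.Properties
  open import Data.Nat.Tactic.RingSolver using (solve-∀)
  open import Relation.Nullary using (yes; no; contradiction)
  open import Relation.Binary.PropositionalEquality using (_≡_; cong)

  private
    cube-split : ∀ c n → c * (n * (n * (n * 1))) + n * (n * n) ≡ n * (n * n) * (1 + c)
    cube-split = solve-∀
    regroup : ∀ n F F′ R d → n * (F + F′ + R) * d ≡ F′ * n * d + n * (d * (F + R))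
    regroup = solve-∀
    double : ∀ n → n * n + n * n ≡ 2 * (n * n)
    double = solve-∀
    expand : ∀ d n x R → 2 * (d * (n * x + R + R)) ≡ n * (2 * d * x) + 4 * d * R
    expand = solve-∀
    square : ∀ d x y → (2 * d * x) * (2 * d * y) ≡ 4 * (d * d) * (x * y)
    square = solve-∀

  few-owned-elsewhere⇒ : ∀ n d′ F F′ R → let d = suc d′ in
    n * n ≤ F + F′ + R → F′ * n * d ≤ d′ * n ^ 3 → n * n ≤ d * (F + R)
  few-owned-elsewhere⇒ zero      d′ F F′ R _ _ = z≤n
  few-owned-elsewhere⇒ n@(suc _) d′ F F′ R n²≤ F′≤ =
    *-cancelˡ-≤ n (+-cancelˡ-≤ (d′ * n ^ 3) _ _ (begin
      d′ * n ^ 3 + n * (n * n)              ≡⟨ cube-split d′ n ⟩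
      n * (n * n) * d                      ≤⟨ *-monoˡ-≤ d (*-monoʳ-≤ n n²≤) ⟩
      n * (F + F′ + R) * d                 ≡⟨ regroup n F F′ R d ⟩
      F′ * n * d + n * (d * (F + R))       ≤⟨ +-monoˡ-≤ _ F′≤ ⟩
      d′ * n ^ 3 + n * (d * (F + R))       ∎))
    where
    d = suc d′
    open ≤-Reasoning

  many-exclusive : ∀ n d′ x R → let d = suc d′ in
    n * n ≤ d * (n * x + R + R) → 4 * (d * d) * R < n * n → n < 2 * d * x
  many-exclusive n d′ x R n²≤ R-small = *-cancelˡ-< n n (2 * d * x) (+-cancelʳ-< (n * n) (n * n) _ (begin-strict
      n * n + n * n                      ≡⟨ double n ⟩
      2 * (n * n)                        ≤⟨ *-monoʳ-≤ 2 n²≤ ⟩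
      2 * (d * (n * x + R + R))          ≡⟨ expand d n x R ⟩
      n * (2 * d * x) + 4 * d * R        <⟨ +-monoʳ-< (n * (2 * d * x)) (≤-<-trans 4dR≤4d²R R-small) ⟩
      n * (2 * d * x) + n * n            ∎))
    where
    d = suc d′
    open ≤-Reasoning
    4dR≤4d²R : 4 * d * R ≤ 4 * (d * d) * R
    4dR≤4d²R = *-monoˡ-≤ R (*-monoʳ-≤ 4 (m≤m*n d d))

  -- F_q: entries owned and computed locally by processor q, so F_q n ≤ ε n³ with ε ≤ d′ / d;
  -- x, y: rows of A held by processor 0 only, columns of B held by processor 1 only;
  -- R: words received.
  n²≤4d²R : ∀ n d′ F₀ F₁ R x y → let d = suc d′ in
    n * n ≤ F₀ + F₁ + R →
    F₀ * n * d ≤ d′ * n ^ 3 → F₁ * n * d ≤ d′ * n ^ 3 →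
    F₀ ≤ n * x + R → F₁ ≤ n * y + R → x * y ≤ R →
    n * n ≤ 4 * (d * d) * R
  n²≤4d²R n d′ F₀ F₁ R x y n²≤ F₀≤ F₁≤ F₀≤nx F₁≤ny xy≤R with n * n ≤? 4 * (suc d′ * suc d′) * R
  ... | yes n²≤4d²R = n²≤4d²R
  ... | no n²≰4d²R = contradiction (begin
      n * n                           ≤⟨ *-mono-≤ (<⇒≤ n<2dx) (<⇒≤ n<2dy) ⟩
      (2 * d * x) * (2 * d * y)       ≡⟨ square d x y ⟩
      4 * (d * d) * (x * y)           ≤⟨ *-monoʳ-≤ (4 * (d * d)) xy≤R ⟩
      4 * (d * d) * R                 ∎) n²≰4d²R
    where
    d = suc d′
    open ≤-Reasoning
    R-small = ≰⇒> n²≰4d²R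
    n<2dx : n < 2 * d * x
    n<2dx = many-exclusive n d′ x R (≤-trans (few-owned-elsewhere⇒ n d′ F₀ F₁ R n²≤ F₁≤)
              (*-monoʳ-≤ d (+-monoˡ-≤ R F₀≤nx))) R-small
    n<2dy : n < 2 * d * y
    n<2dy = many-exclusive n d′ y R (≤-trans (few-owned-elsewhere⇒ n d′ F₁ F₀ R
              (≤-trans n²≤ (≤-reflexive (cong (_+ R) (+-comm F₀ F₁)))) F₀≤)
              (*-monoʳ-≤ d (+-monoˡ-≤ R F₁≤ny))) R-small

open Execution

module Analysis {n : ℕ} (alg : BSPAlgorithm n) (s : State n) (Rc : Proc → List (Expr n))
  (traced : TracedState (BSPAlgorithm.init alg) Rc s)
  (not-replicated : NotReplicated alg) (computes : ComputesProduct s) where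

  open Terms
  open Counting
  open import Data.Nat using (zero; suc; _+_; _*_; _≤_)
  open import Data.Nat.Properties using (*-comm; *-monoʳ-≤; *-distribˡ-+; +-monoʳ-≤; +-monoˡ-≤; module ≤-Reasoning)
  open import Data.Fin using (Fin; zero; suc)
  open import Data.Fin.Properties using (all?) renaming (_≟_ to _≟ᶠ_)
  open import Data.List using (_++_; map; length; filter; allFin; cartesianProduct)
  open import Data.List.Properties using (length-map; length-tabulate)
  open import Data.List.Membership.Propositional using (_∈_)
  open import Data.List.Membership.Propositional.Properties using (∈-++⁺ˡ; ∈-++⁺ʳ; ∈-filter⁻)
  open import Data.List.Membership.DecPropositional (_≟ᵉ_ {n}) using (_∈?_)
  open import Data.List.Relation.Unary.All using (All)
  import Data.List.Relation.Unary.All.Properties as All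
  open import Data.List.Relation.Unary.Unique.Propositional using (Unique)
  import Data.List.Relation.Unary.Unique.Propositional.Properties as Unique
  open import Data.Product using (_×_; _,_; ∃; proj₁; proj₂; swap)
  open import Data.Sum using (_⊎_; inj₁; inj₂)
  open import Function using (_∘_)
  open import Relation.Nullary using (yes; no; ¬_; contradiction)
  open import Relation.Nullary.Decidable using (_×-dec_; ¬?)
  open import Relation.Unary using (Pred; Decidable; _∪_; _⟨×⟩_)
  open import Relation.Unary.Properties using (_∪?_; _×?_)
  open import Relation.Binary.PropositionalEquality using (_≡_; refl; sym; trans; cong; cong₂; setoid; module ≡-Reasoning)

  Entry : Set
  Entry = Fin n × Fin n

  indices : List (Fin n)
  indices = allFin n

  entries : List Entry
  entries = cartesianProduct indices indices

  unique-entries : Unique entries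
  unique-entries = Unique.cartesianProduct⁺ (Unique.allFin⁺ n) (Unique.allFin⁺ n)

  receivedWords : List (Expr n)
  receivedWords = Rc zero ++ Rc (suc zero)

  R : ℕ
  R = length receivedWords

  owner : Fin n → Fin n → Proc
  owner i j = proj₁ (computes i j)

  OwnedLocally : Proc → Pred Entry _
  OwnedLocally q (i , j) = owner i j ≡ q × Local s q i j

  ownedLocally? : ∀ q → Decidable (OwnedLocally q)
  ownedLocally? q (i , j) = (owner i j ≟ᶠ q) ×-dec local? s q i j

  Remote : Pred Entry _
  Remote (i , j) = ¬ Local s (owner i j) i j

  remote? : Decidable Remote
  remote? (i , j) = ¬? (local? s (owner i j) i j)

  Line : Set
  Line = Fin n → Fin n → Var n

  row col : Line
  row i k = a i k
  col j k = b k j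

  Holds : Proc → Var n → Set
  Holds q v = var v ∈ State.mem s q

  HoldsLine : Proc → Line → Pred (Fin n) _
  HoldsLine q ℓ i = ∀ k → Holds q (ℓ i k)

  holdsLine? : ∀ q ℓ → Decidable (HoldsLine q ℓ)
  holdsLine? q ℓ i = all? (λ k → var (ℓ i k) ∈? State.mem s q)

  Shared : Line → Pred (Fin n) _
  Shared ℓ i = ∀ q → HoldsLine q ℓ i

  shared? : ∀ ℓ → Decidable (Shared ℓ)
  shared? ℓ i = all? (λ q → holdsLine? q ℓ i)

  Exclusive : Proc → Line → Pred (Fin n) _
  Exclusive q ℓ i = HoldsLine q ℓ i × ¬ HoldsLine (other q) ℓ i

  exclusive? : ∀ q ℓ → Decidable (Exclusive q ℓ)
  exclusive? q ℓ i = holdsLine? q ℓ i ×-dec ¬? (holdsLine? (other q) ℓ i)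

  both-processors : ∀ {P : Proc → Set} q → P q → P (other q) → ∀ q′ → P q′
  both-processors zero       p p′ zero       = p
  both-processors zero       p p′ (suc zero) = p′
  both-processors (suc zero) p p′ zero       = p′
  both-processors (suc zero) p p′ (suc zero) = p

  held-input-or-received : ∀ q v → Holds q v → v ∈ BSPAlgorithm.init alg q ⊎ var v ∈ Rc q
  held-input-or-received q v held with provenance (traced q) held
  ... | input v∈I     = inj₁ v∈I
  ... | received v∈Rc = inj₂ v∈Rc

  held-by-both⇒received : ∀ v → (∀ q → Holds q v) → var v ∈ receivedWords
  held-by-both⇒received v held
    with held-input-or-received zero v (held zero) | held-input-or-received (suc zero) v (held (suc zero))
  ... | inj₂ v∈Rc₀ | _         = ∈-++⁺ˡ v∈Rc₀
  ... | inj₁ _     | inj₂ v∈Rc₁ = ∈-++⁺ʳ (Rc zero) v∈Rc₁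
  ... | inj₁ v∈I₀  | inj₁ v∈I₁
    with _ , _ , unique ← not-replicated v
    with () ← trans (unique zero v∈I₀) (sym (unique (suc zero) v∈I₁))

  LineInjective : Line → Set
  LineInjective ℓ = ∀ {i k i′ k′} → ℓ i k ≡ ℓ i′ k′ → i ≡ i′ × k ≡ k′

  row-injective : LineInjective row
  row-injective refl = refl , refl

  col-injective : LineInjective col
  col-injective refl = refl , refl

  length-indices : length indices ≡ n
  length-indices = length-tabulate (λ i → i)

  shared-lines≤ : ∀ ℓ → LineInjective ℓ → n * count (shared? ℓ) indices ≤ R
  shared-lines≤ ℓ ℓ-injective = begin
    n * count (shared? ℓ) indices                     ≡⟨ *-comm n _ ⟩
    count (shared? ℓ) indices * n                     ≡⟨ cong (count (shared? ℓ) indices *_) length-indices ⟨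
    count (shared? ℓ) indices * length indices        ≡⟨ count-proj₁ (shared? ℓ) indices indices ⟨
    count (shared? ℓ ∘ proj₁) entries                 ≤⟨ injection⇒count≤length (shared? ℓ ∘ proj₁) Word injective
                                                           unique-entries receivedWords witness ⟩
    R                                                 ∎
    where
    open ≤-Reasoning
    Word : Entry → Expr n → Set
    Word (i , k) w = w ≡ var (ℓ i k)
    injective : ∀ {x x′ w} → Word x w → Word x′ w → x ≡ x′
    injective {i , k} {i′ , k′} refl eq with refl , refl ← ℓ-injective (var-injective eq) = refl
    witness : ∀ {x} → x ∈ entries → Shared ℓ (proj₁ x) → ∃ λ w → w ∈ receivedWords × Word x w
    witness {i , k} _ shared = var (ℓ i k) , held-by-both⇒received (ℓ i k) (λ q → shared q k) , refl

  held-lines≤ : ∀ q ℓ → LineInjective ℓ →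
    n * count (holdsLine? q ℓ) indices ≤ n * count (exclusive? q ℓ) indices + R
  held-lines≤ q ℓ ℓ-injective = begin
    n * count (holdsLine? q ℓ) indices
      ≤⟨ *-monoʳ-≤ n (count-mono (holdsLine? q ℓ) (exclusive? q ℓ ∪? shared? ℓ) exclusive-or-shared indices) ⟩
    n * count (exclusive? q ℓ ∪? shared? ℓ) indices
      ≤⟨ *-monoʳ-≤ n (count-∪ (exclusive? q ℓ) (shared? ℓ) indices) ⟩
    n * (count (exclusive? q ℓ) indices + count (shared? ℓ) indices)
      ≡⟨ *-distribˡ-+ n _ _ ⟩
    n * count (exclusive? q ℓ) indices + n * count (shared? ℓ) indices
      ≤⟨ +-monoʳ-≤ _ (shared-lines≤ ℓ ℓ-injective) ⟩
    n * count (exclusive? q ℓ) indices + R ∎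
    where
    open ≤-Reasoning
    exclusive-or-shared : ∀ {i} → HoldsLine q ℓ i → Exclusive q ℓ i ⊎ Shared ℓ i
    exclusive-or-shared {i} holds with holdsLine? (other q) ℓ i
    ... | yes holds′ = inj₂ (both-processors q holds holds′)
    ... | no ¬holds′ = inj₁ (holds , ¬holds′)

  local⇒lines : ∀ {q i j} → Local s q i j → HoldsLine q row i × HoldsLine q col j
  local⇒lines {q} local = (λ k → proj₁ (factors-of (local k))) , (λ k → proj₂ (factors-of (local k)))
    where
    factors-of : ∀ {i k j} → TermComputedBy s q (i , k , j) → Holds q (a i k) × Holds q (b k j)
    factors-of (_ , e∈ , ab) = factors (traced q) e∈
    factors-of (_ , e∈ , ba) = swap (factors (traced q) e∈)

  ownedLocally≤rows : ∀ q → count (ownedLocally? q) entries ≤ n * count (exclusive? q row) indices + R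
  ownedLocally≤rows q = begin
    count (ownedLocally? q) entries
      ≤⟨ count-mono (ownedLocally? q) (holdsLine? q row ∘ proj₁) (proj₁ ∘ local⇒lines ∘ proj₂) entries ⟩
    count (holdsLine? q row ∘ proj₁) entries        ≡⟨ count-proj₁ (holdsLine? q row) indices indices ⟩
    count (holdsLine? q row) indices * length indices ≡⟨ cong (count (holdsLine? q row) indices *_) length-indices ⟩
    count (holdsLine? q row) indices * n            ≡⟨ *-comm _ n ⟩
    n * count (holdsLine? q row) indices            ≤⟨ held-lines≤ q row row-injective ⟩
    n * count (exclusive? q row) indices + R        ∎
    where open ≤-Reasoning

  ownedLocally≤cols : ∀ q → count (ownedLocally? q) entries ≤ n * count (exclusive? q col) indices + R
  ownedLocally≤cols q = begin
    count (ownedLocally? q) entries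
      ≤⟨ count-mono (ownedLocally? q) (holdsLine? q col ∘ proj₂) (proj₂ ∘ local⇒lines ∘ proj₂) entries ⟩
    count (holdsLine? q col ∘ proj₂) entries        ≡⟨ count-proj₂ (holdsLine? q col) indices indices ⟩
    length indices * count (holdsLine? q col) indices ≡⟨ cong (_* count (holdsLine? q col) indices) length-indices ⟩
    n * count (holdsLine? q col) indices            ≤⟨ held-lines≤ q col col-injective ⟩
    n * count (exclusive? q col) indices + R        ∎
    where open ≤-Reasoning

  entries-covered : n * n ≤ count (ownedLocally? zero) entries + count (ownedLocally? (suc zero)) entries
                             + count remote? entries
  entries-covered = begin
    n * n                                   ≡⟨ cong₂ _*_ length-indices length-indices ⟨
    length indices * length indices         ≡⟨ length-cartesianProduct indices indices ⟨
    length entries                          ≡⟨ count-universal classified? classify entries ⟨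
    count classified? entries               ≤⟨ count-∪ (ownedLocally? zero ∪? ownedLocally? (suc zero)) remote? entries ⟩
    count (ownedLocally? zero ∪? ownedLocally? (suc zero)) entries + count remote? entries
      ≤⟨ +-monoˡ-≤ _ (count-∪ (ownedLocally? zero) (ownedLocally? (suc zero)) entries) ⟩
    count (ownedLocally? zero) entries + count (ownedLocally? (suc zero)) entries + count remote? entries ∎
    where
    open ≤-Reasoning
    classified? = (ownedLocally? zero ∪? ownedLocally? (suc zero)) ∪? remote?
    classify : ∀ x → ((OwnedLocally zero ∪ OwnedLocally (suc zero)) ∪ Remote) x
    classify (i , j) with owner i j | local? s (owner i j) i j
    ... | zero     | yes local = inj₁ (inj₁ (refl , local))
    ... | suc zero | yes local = inj₁ (inj₂ (refl , local))
    ... | _        | no ¬local = inj₂ ¬local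

  remote≤received : count remote? entries ≤ R
  remote≤received = injection⇒count≤length remote? (λ x → AllTermsOf (proj₁ x) (proj₂ x))
                      (λ {x} {x′} {w} → injective {x} {x′} {w})
                      unique-entries receivedWords witness
    where
    injective : ∀ {x x′ w} → AllTermsOf (proj₁ x) (proj₂ x) w → AllTermsOf (proj₁ x′) (proj₂ x′) w → x ≡ x′
    injective {_ , _} {_ , _} {w} terms terms′ with refl , refl ← AllTermsOf-injective {w = w} terms terms′ = refl
    received-by : ∀ q {w} → w ∈ Rc q → w ∈ receivedWords
    received-by zero       = ∈-++⁺ˡ
    received-by (suc zero) = ∈-++⁺ʳ (Rc zero)
    witness : ∀ {x} → x ∈ entries → Remote x → ∃ λ w → w ∈ receivedWords × AllTermsOf (proj₁ x) (proj₂ x) w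
    witness {i , j} _ remote
      with q , e , e∈ , computes-ij ← computes i j
      with entry-local-or-received s q (traced q) e∈ computes-ij
    ... | inj₁ local              = contradiction local remote
    ... | inj₂ (w , w∈Rc , terms) = w , received-by q w∈Rc , terms

  exclusive×exclusive≤remote :
    count (exclusive? zero row) indices * count (exclusive? (suc zero) col) indices ≤ count remote? entries
  exclusive×exclusive≤remote = begin
    count (exclusive? zero row) indices * count (exclusive? (suc zero) col) indices
      ≡⟨ count-⟨×⟩ (exclusive? zero row) (exclusive? (suc zero) col) indices indices ⟨
    count (exclusive? zero row ×? exclusive? (suc zero) col) entries
      ≤⟨ count-mono (exclusive? zero row ×? exclusive? (suc zero) col) remote? (λ {x} → nowhere-local x) entries ⟩
    count remote? entries ∎
    where
    open ≤-Reasoning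
    nowhere-local : ∀ x → (Exclusive zero row ⟨×⟩ Exclusive (suc zero) col) x → Remote x
    nowhere-local (i , j) (row-only-0 , col-only-1) with owner i j
    ... | zero     = proj₂ col-only-1 ∘ proj₂ ∘ local⇒lines
    ... | suc zero = proj₂ row-only-0 ∘ proj₁ ∘ local⇒lines

  Term : Entry × Fin n → Triple n
  Term ((i , j) , k) = i , k , j

  ownedLocallyEntries : Proc → List Entry
  ownedLocallyEntries q = filter (ownedLocally? q) entries

  terms-owned-locally : Proc → List (Triple n)
  terms-owned-locally q = map Term (cartesianProduct (ownedLocallyEntries q) indices)

  unique-terms-owned-locally : ∀ q → Unique (terms-owned-locally q)
  unique-terms-owned-locally q = Unique.map⁺ Term-injective
    (Unique.cartesianProduct⁺ (Unique.filter⁺ (ownedLocally? q) unique-entries) (Unique.allFin⁺ n))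
    where
    Term-injective : ∀ {x y} → Term x ≡ Term y → x ≡ y
    Term-injective {((_ , _) , _)} {((_ , _) , _)} refl = refl

  terms-owned-locally-computed : ∀ q → All (TermComputedBy s q) (terms-owned-locally q)
  terms-owned-locally-computed q = All.map⁺ (All.cartesianProduct⁺ (setoid _) (setoid _) _ _ computed)
    where
    computed : ∀ {x k} → x ∈ ownedLocallyEntries q → k ∈ indices → TermComputedBy s q (Term (x , k))
    computed x∈ _ = proj₂ (proj₂ (∈-filter⁻ (ownedLocally? q) {xs = entries} x∈)) _

  length-terms-owned-locally : ∀ q → length (terms-owned-locally q) ≡ count (ownedLocally? q) entries * n
  length-terms-owned-locally q = begin
    length (terms-owned-locally q)
      ≡⟨ length-map Term (cartesianProduct (ownedLocallyEntries q) indices) ⟩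
    length (cartesianProduct (ownedLocallyEntries q) indices)
      ≡⟨ length-cartesianProduct (ownedLocallyEntries q) indices ⟩
    count (ownedLocally? q) entries * length indices
      ≡⟨ cong (count (ownedLocally? q) entries *_) length-indices ⟩
    count (ownedLocally? q) entries * n ∎
    where open ≡-Reasoning

open Counting
open Rationals
open Arithmetic
open import Data.Nat using (_^_)
import Data.Nat as ℕ
open import Data.Fin using (zero; suc)
open import Data.Nat.Properties using (*-identityʳ; *-monoʳ-≤; +-monoʳ-≤; ≤-trans; ≤-reflexive; module ≤-Reasoning)
open import Data.Nat.Tactic.RingSolver using (solve-∀)
open import Data.List using (length)
open import Data.List.Properties using (length-++)
open import Data.Product using (_×_; ∃; _,_)
open import Data.Maybe using (just)
open import Data.Rational using (ℚ; mkℚ; _<_; _≤_; _*_; _/_; ½; 0ℚ; 1ℚ; ↧ₙ_)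
open import Data.Integer using (+_)
open import Relation.Binary.PropositionalEquality using (_≡_; cong; subst)

private
  double-scaled : ∀ c H → 4 ℕ.* c ℕ.* (H ℕ.+ H) ≡ 8 ℕ.* c ℕ.* H
  double-scaled = solve-∀

n²≤8d²H : (ε : ℚ) → ε < 1ℚ → ∀ {n} (alg : BSPAlgorithm n) (s : State n) → run alg ≡ just s →
  NotReplicated alg → ComputesProduct s → ((q : Proc) → AtMostTerms ε s q) →
  n ^ 2 ℕ.≤ 8 ℕ.* (↧ₙ ε ℕ.* ↧ₙ ε) ℕ.* H alg
n²≤8d²H ε@(mkℚ _ d′ _) ε<1 {n} alg s run≡ not-replicated computes at-most
  with Rc , traced , received≤2H ← traced-run alg run≡ = begin
    n ^ 2                                 ≡⟨ cong (n ℕ.*_) (*-identityʳ n) ⟩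
    n ℕ.* n                               ≤⟨ n²≤4d²R n d′ F₀ F₁ R x y covered (few-terms zero) (few-terms (suc zero))
                                               (ownedLocally≤rows zero) (ownedLocally≤cols (suc zero))
                                               (≤-trans exclusive×exclusive≤remote remote≤received) ⟩
    4 ℕ.* (d ℕ.* d) ℕ.* R                 ≤⟨ *-monoʳ-≤ (4 ℕ.* (d ℕ.* d)) R≤2H ⟩
    4 ℕ.* (d ℕ.* d) ℕ.* (H alg ℕ.+ H alg) ≡⟨ double-scaled (d ℕ.* d) (H alg) ⟩
    8 ℕ.* (d ℕ.* d) ℕ.* H alg             ∎
  where
  open ≤-Reasoning
  open Analysis alg s Rc traced not-replicated computes
  d = ℕ.suc d′
  F₀ = count (ownedLocally? zero) entries
  F₁ = count (ownedLocally? (suc zero)) entries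
  x = count (exclusive? zero row) indices
  y = count (exclusive? (suc zero) col) indices
  R≤2H = ≤-trans (≤-reflexive (length-++ (Rc zero))) received≤2H
  covered = ≤-trans entries-covered (+-monoʳ-≤ (F₀ ℕ.+ F₁) remote≤received)
  few-terms : ∀ q → count (ownedLocally? q) entries ℕ.* n ℕ.* d ℕ.≤ d′ ℕ.* n ^ 3
  few-terms q = subst (λ m → m ℕ.* d ℕ.≤ d′ ℕ.* n ^ 3) (length-terms-owned-locally q)
    (ℕtoℚ-≤-*⇒ ε (length (terms-owned-locally q)) (n ^ 3) ε<1
      (at-most q (terms-owned-locally q) (unique-terms-owned-locally q) (terms-owned-locally-computed q)))

lemma1 : (ε : ℚ) → ½ < ε → ε < 1ℚ →
    ∃ λ (c : ℚ) → 0ℚ < c × ∃ λ (N : ℕ) →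
      (n : ℕ) → N Data.Nat.≤ n →
      (alg : BSPAlgorithm n) (s : State n) → run alg ≡ just s →
      NotReplicated alg →
      ComputesProduct s →
      ((q : Proc) → AtMostTerms ε s q) →
      c * ℕtoℚ (n ^ 2) ≤ ℕtoℚ (H alg)
lemma1 ε _ ε<1 = + 1 / k , 0<1/ k , 0 ,
  λ n _ alg s run≡ not-replicated computes at-most →
    1/-*-ℕtoℚ-≤ k (n ^ 2) (H alg) (n²≤8d²H ε ε<1 alg s run≡ not-replicated computes at-most)
  where
  k = 8 ℕ.* (↧ₙ ε ℕ.* ↧ₙ ε)
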